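{- Let $H\ge 1$ and let $f(x)=A_0+A_1x+A_2x^2\in\mathbb{Z}[x]$ with $A_2\neq 0$, $\max\{|A_0|,|A_1|,|A_2|\}\le H$ and $A_1\neq 0$. If $f$ is a Dumas polynomial, then $A_0,A_1,A_2$ are not pairwise coprime, i.e. $\gcd(A_j,A_k)\neq 1$ for some distinct $j,k\in\{0,1,2\}$.
   Context: Newton diagram: let $p$ be a prime and $f(x)=\sum_{i=0}^n A_i x^i\in\mathbb{Z}[x]$ with $A_0A_n\neq 0$. For each nonzero coefficient write $A_i = a_i p^{\alpha_i}$ with $\gcd(a_i,p)=1$, and plot the point $(i,\alpha_i)$. Let $P_0=(0,\alpha_0)$; given $P_k=(i_k,\alpha_{i_k})$ with $i_k<n$, let $P_{k+1}$ be the plotted point with the largest index $i_{k+1}$ such that no plotted point lies strictly below the line $P_kP_{k+1}$; continue until reaching $P_r=(n,\alpha_n)$ (the lower convex hull of the plotted points). Integer-coordinate points lying on segments of the broken line $P_0\cdots P_r$ are also declared vertices; the resulting broken line is the Newton diagram of $f$ with respect to $p$, with segments between consecutive vertices. A polynomial $f\in\mathbb{Z}[x]$ with nonzero leading coefficient and nonzero constant term is a Dumas polynomial if for some prime $p$ its Newton diagram with respect to $p$ consists of precisely one segment, i.e. a single segment from $(0,\alpha_0)$ to $(n,\alpha_n)$ containing no integer-coordinate points other than its endpoints. (In particular a Dumas polynomial has $A_0\neq 0$.) -}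

module Defs where

open import Data.Nat as ℕ using (ℕ; zero; suc)
open import Data.Nat.Divisibility using () renaming (_∣_ to _∣ℕ_)
open import Data.Nat.Primality using (Prime)
open import Data.Integer as ℤ using (ℤ; +_; ∣_∣)
open import Data.Fin using (Fin; toℕ; fromℕ)
open import Data.Product using (Σ; ∃; _×_)
open import Relation.Nullary using (¬_)
open import Relation.Binary.PropositionalEquality using (_≡_; _≢_)

Val : ℕ → ℤ → ℕ → Set
Val p A α = Σ ℤ λ a → (A ≡ a ℤ.* (+ p) ℤ.^ α) × ¬ (p ∣ℕ ∣ a ∣)

-- f(x) = Σ_{i=0}^n A i x^i, coefficients indexed by Fin (suc n).
-- Newton diagram of f w.r.t. p consists of precisely one segment:
--  * every plotted point (i, α_i) (A i ≠ 0) lies on or above the line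
--    through P0 = (0, α_0) and Pn = (n, α_n), i.e. the lower convex hull is
--    the single segment P0 Pn;
--  * no integer point (i, y) with 0 < i < n lies on that segment.
OneSegmentNewton : (n : ℕ) → (Fin (suc n) → ℤ) → ℕ → Set
OneSegmentNewton n A p =
  ∃ λ α₀ → ∃ λ αₙ → Val p (A Data.Fin.zero) α₀ × Val p (A (fromℕ n)) αₙ
    × ((i : Fin (suc n)) (α : ℕ) → A i ≢ + 0 → Val p (A i) α →
         (n ℕ.∸ toℕ i) ℕ.* α₀ ℕ.+ toℕ i ℕ.* αₙ ℕ.≤ n ℕ.* α)
    × ((i y : ℕ) → 0 ℕ.< i → i ℕ.< n →
         n ℕ.* y ≢ (n ℕ.∸ i) ℕ.* α₀ ℕ.+ i ℕ.* αₙ)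

Dumas : (n : ℕ) → (Fin (suc n) → ℤ) → Set
Dumas n A = (A Data.Fin.zero ≢ + 0) × (A (fromℕ n) ≢ + 0)
  × ∃ λ p → Prime p × OneSegmentNewton n A p

-- If p did not divide A₁, the hull condition at i = 1 would force α₀ + α₂ ≤ 0, so
-- both endpoints of the segment would lie at height 0 and its midpoint (1, 0) would be
-- a lattice point. Hence p ∣ A₁. For the same reason α₀ ≠ α₂, so one of α₀, α₂ is
-- positive and p also divides A₀ or A₂.
module Submission where

open import Defs
open import Data.Nat using (ℕ)
open import Data.Integer using (ℤ; +_; ∣_∣; _≤_)
open import Data.Integer.GCD using (gcd)
open import Data.Vec using (_∷_; []; lookup)
open import Data.Sum using (_⊎_)
open import Data.Product using (_×_)
open import Relation.Binary.PropositionalEquality using (_≢_)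

open import Data.Nat as ℕ using (zero; suc; _∸_; s≤s; z≤n)
open import Data.Nat.Properties using (*-identityˡ; +-comm; m+n≤o⇒m≤o; m+n≤o⇒n≤o; n≤0⇒n≡0)
open import Data.Nat.Divisibility using (_∣_; _∣?_; ∣1⇒≡1)
open import Data.Nat.GCD using (gcd-greatest)
open import Data.Nat.Primality using (Prime; ¬prime[1])
import Data.Integer as ℤ
import Data.Integer.Properties as ℤ
open import Data.Integer.Divisibility.Signed using (∣⇒∣ᵤ; ∣-refl; ∣m⇒∣m*n; ∣n⇒∣m*n)
open import Data.Fin using (Fin)
open import Data.Product using (_,_)
open import Data.Sum using (inj₁; inj₂)
open import Data.Empty using (⊥-elim)
open import Relation.Nullary using (¬_; yes; no)
open import Relation.Binary.PropositionalEquality using (_≡_; refl; sym; trans; cong; subst)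

Val-suc⇒∣ : ∀ {p A k} → Val p A (suc k) → p ∣ ∣ A ∣
Val-suc⇒∣ {p} {k = k} (a , refl , _) = ∣⇒∣ᵤ (∣n⇒∣m*n a (∣m⇒∣m*n ((+ p) ℤ.^ k) (∣-refl {+ p})))

∤⇒Val-zero : ∀ {p A} → ¬ p ∣ ∣ A ∣ → Val p A 0
∤⇒Val-zero {A = A} p∤A = A , sym (ℤ.*-identityʳ A) , p∤A

prime∣both⇒gcd≢1 : ∀ {p} → Prime p → ∀ X Y → p ∣ ∣ X ∣ → p ∣ ∣ Y ∣ → gcd X Y ≢ + 1
prime∣both⇒gcd≢1 {p} pp X Y p∣X p∣Y gcd≡1 =
  ¬prime[1] (subst Prime (∣1⇒≡1 (subst (p ∣_) (ℤ.+-injective gcd≡1) (gcd-greatest p∣X p∣Y))) pp)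

-- With both endpoints at height α, the point (1, α) lies on the segment.
no-interior-point⇒ends-differ : ∀ {m α₀ αₙ} →
  ((i y : ℕ) → 0 ℕ.< i → i ℕ.< suc (suc m) →
     suc (suc m) ℕ.* y ≢ (suc (suc m) ∸ i) ℕ.* α₀ ℕ.+ i ℕ.* αₙ) →
  α₀ ≢ αₙ
no-interior-point⇒ends-differ {m} {α} noPoint refl =
  noPoint 1 α (s≤s z≤n) (s≤s (s≤s z≤n))
    (trans (+-comm α (suc m ℕ.* α)) (cong (suc m ℕ.* α ℕ.+_) (sym (*-identityˡ α))))

module _ {A₀ A₁ A₂ : ℤ} {p α₀ α₂ : ℕ} where

  private
    A : Fin 3 → ℤ
    A = lookup (A₀ ∷ A₁ ∷ A₂ ∷ [])

  quadratic-one-segment⇒∣middle : A₁ ≢ + 0 →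
    ((i : Fin 3) (α : ℕ) → A i ≢ + 0 → Val p (A i) α →
       (2 ∸ Data.Fin.toℕ i) ℕ.* α₀ ℕ.+ Data.Fin.toℕ i ℕ.* α₂ ℕ.≤ 2 ℕ.* α) →
    ((i y : ℕ) → 0 ℕ.< i → i ℕ.< 2 → 2 ℕ.* y ≢ (2 ∸ i) ℕ.* α₀ ℕ.+ i ℕ.* α₂) →
    p ∣ ∣ A₁ ∣
  quadratic-one-segment⇒∣middle A₁≢0 above noPoint with p ∣? ∣ A₁ ∣
  ... | yes p∣A₁ = p∣A₁
  ... | no p∤A₁ = ⊥-elim (no-interior-point⇒ends-differ noPoint (trans α₀≡0 (sym α₂≡0)))
    where
    α₀+α₂≤0 : α₀ ℕ.+ 1 ℕ.* α₂ ℕ.≤ 0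
    α₀+α₂≤0 = subst (λ x → x ℕ.+ 1 ℕ.* α₂ ℕ.≤ 0) (*-identityˡ α₀)
                (above (Fin.suc Fin.zero) 0 A₁≢0 (∤⇒Val-zero p∤A₁))
    α₀≡0 : α₀ ≡ 0
    α₀≡0 = n≤0⇒n≡0 (m+n≤o⇒m≤o α₀ α₀+α₂≤0)
    α₂≡0 : α₂ ≡ 0
    α₂≡0 = n≤0⇒n≡0 (subst (ℕ._≤ 0) (*-identityˡ α₂) (m+n≤o⇒n≤o α₀ α₀+α₂≤0))

lemma1 : (H : ℕ) → 1 Data.Nat.≤ H → (A₀ A₁ A₂ : ℤ) → A₂ ≢ + 0
    → ∣ A₀ ∣ Data.Nat.≤ H → ∣ A₁ ∣ Data.Nat.≤ H → ∣ A₂ ∣ Data.Nat.≤ H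
    → A₁ ≢ + 0
    → Dumas 2 (lookup (A₀ ∷ A₁ ∷ A₂ ∷ []))
    → (gcd A₀ A₁ ≢ + 1) ⊎ (gcd A₀ A₂ ≢ + 1) ⊎ (gcd A₁ A₂ ≢ + 1)
lemma1 _ _ A₀ A₁ A₂ _ _ _ _ A₁≢0 (_ , _ , p , pp , α₀ , α₂ , v₀ , v₂ , above , noPoint) =
  ends v₀ v₂ (no-interior-point⇒ends-differ noPoint)
  where
  p∣A₁ : p ∣ ∣ A₁ ∣
  p∣A₁ = quadratic-one-segment⇒∣middle A₁≢0 above noPoint
  ends : ∀ {a b} → Val p A₀ a → Val p A₂ b → a ≢ b →
         (gcd A₀ A₁ ≢ + 1) ⊎ (gcd A₀ A₂ ≢ + 1) ⊎ (gcd A₁ A₂ ≢ + 1)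
  ends {suc a} v₀ _ _ = inj₁ (prime∣both⇒gcd≢1 pp A₀ A₁ (Val-suc⇒∣ {k = a} v₀) p∣A₁)
  ends {zero} {suc b} _ v₂ _ = inj₂ (inj₂ (prime∣both⇒gcd≢1 pp A₁ A₂ p∣A₁ (Val-suc⇒∣ {k = b} v₂)))
  ends {zero} {zero} _ _ 0≢0 = ⊥-elim (0≢0 refl)
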